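{- Fix integers $2\le r\le k$. There is a constant $c=c(k,r)>0$ such that every $n$-vertex, $m$-edge $k$-uniform multihypergraph has an $r$-cut with excess at least $cm/n$.
   Context: A $k$-uniform multihypergraph has a vertex set and a multiset of $k$-element vertex subsets (edges). An $r$-cut is a partition of the vertex set into $r$ labelled parts; its size is the number of edges (with multiplicity) having a vertex in every part; its excess is its size minus $\frac{S(k,r)r!}{r^k}m$, where $S(k,r)$ is the Stirling number of the second kind. -}

module Defs where

open import Data.Nat using (ℕ; zero; suc; _+_; _^_; NonZero; _!)
import Data.Nat as ℕ
open import Data.Nat.Properties using (m^n≢0)
open import Data.Bool using (Bool; true; false; _∧_; if_then_else_)
open import Data.Fin using (Fin)
open import Data.Fin.Subset using (Subset; ∣_∣)
open import Data.Vec using (lookup)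
open import Data.List using (List; allFin; length; filterᵇ)
open import Data.Bool.ListAction using (all; any)
open import Data.List.Relation.Unary.All using (All)
open import Data.Integer using (+_)
open import Data.Rational using (ℚ; _/_; _-_; _*_; 0ℚ)
open import Relation.Binary.PropositionalEquality using (_≡_)
open import Relation.Nullary.Decidable using (⌊_⌋)
open import Data.Fin using (_≟_)

stirling2 : ℕ → ℕ → ℕ
stirling2 zero    zero    = 1
stirling2 zero    (suc k) = 0
stirling2 (suc n) zero    = 0
stirling2 (suc n) (suc k) = suc k ℕ.* stirling2 n (suc k) + stirling2 n k

ℕ→ℚ : ℕ → ℚ
ℕ→ℚ a = (+ a) / 1

-- the expected fraction S(k,r) r! / r^k  (r = 0 is never used; set to 0)
density : ℕ → ℕ → ℚ
density k zero    = 0ℚ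
density k (suc r) = (+ (stirling2 k (suc r) ℕ.* (suc r) !)) / (suc r ^ k)
  where instance _ = m^n≢0 (suc r) k

record MultiHypergraph (k n : ℕ) : Set where
  field
    edges   : List (Subset n)
    uniform : All (λ e → ∣ e ∣ ≡ k) edges

open MultiHypergraph public

numEdges : ∀ {k n} → MultiHypergraph k n → ℕ
numEdges H = length (edges H)

-- An r-cut: a partition of Fin n into r labelled (possibly empty) parts,
-- i.e. a map assigning each vertex its part.
Cut : ℕ → ℕ → Set
Cut n r = Fin n → Fin r

meetsAll : ∀ {n r} → Cut n r → Subset n → Bool
meetsAll {n} {r} f e =
  all (λ i → any (λ v → lookup e v ∧ ⌊ f v ≟ i ⌋) (allFin n)) (allFin r)

cutSize : ∀ {k n r} → MultiHypergraph k n → Cut n r → ℕ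
cutSize H f = length (filterᵇ (meetsAll f) (edges H))

excess : ∀ {k n r} → MultiHypergraph k n → Cut n r → ℚ
excess {k} {n} {r} H f = ℕ→ℚ (cutSize H f) - density k r * ℕ→ℚ (numEdges H)

-- A uniformly random r-cut meets a fixed k-edge with probability S(k,r) r! / r^k, so the sizes of all
-- r^n cuts add up to m S(k,r) r! r^(n-k).  To gain on this average, fix an involution σ of the vertices
-- and modify every cut by moving each vertex v with σ v < v to the next part whenever v lies in the
-- same part as σ v.  Summed over all cuts, no edge is met less often: the modification changes nothing
-- for an edge avoiding v, it can only help an edge containing both v and σ v, and for an edge
-- containing v but not σ v it merely redistributes the part of v among the cuts.  Moreover an edge
-- containing a pair {v, σ v} gains at least r^(n-k) cuts, namely those putting v and σ v into part 0
-- and the rest of the edge onto all parts but part 1.  Among the 2n involutions u ↦ s - u every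
-- edge, having two vertices u < v, contains a pair of the one with s = u + v, so one of them serves
-- at least m / (2n) edges; some modified cut then has size at least the average plus m / (2n r^k),
-- that is, excess at least m / (2 r^k n).

module Submission where

module Counting where

  open import Data.Bool using (Bool; true; false; T; _∧_; if_then_else_)
  import Data.Bool.Properties as Bool
  open import Data.Bool.Properties using (T-∧; T-≡)
  open import Data.Fin as F using (Fin; zero; suc; toℕ)
  import Data.Fin.Properties as F
  open import Data.Fin.Subset using (Subset; Nonempty; ⊥; ⊤; ⁅_⁆; _∪_; _-_; _∈_; _∉_; ∣_∣; inside; outside)
  open import Data.Fin.Subset.Properties
    using ( _∈?_; ∈⊤; ∉⊥; ⊆⊤; ⊆-antisym; ∣⊤∣≡n; drop-there; x∈⁅x⁆; x∈⁅y⁆⇒x≡y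
          ; x∈p∪q⁺; x∈p∪q⁻; ∪-identityˡ; p─⊥≡p; x∈p∧x≢y⇒x∈p-y)
  open import Data.List as List using (List; []; _∷_; allFin; length; filterᵇ)
  import Data.List.Relation.Unary.All as All
  import Data.List.Relation.Unary.All.Properties as All
  open import Data.List.Relation.Unary.All.Properties using (all⁺; all⁻)
  open import Data.List.Relation.Unary.AllPairs as AllPairs using (AllPairs)
  open import Data.List.Relation.Unary.Any using (Any; here; there; any?)
  import Data.List.Relation.Unary.Any.Properties as Any
  open import Data.List.Relation.Unary.Any.Properties using (any⁺; any⁻)
  import Data.List.Relation.Unary.Unique.Propositional.Properties as Unique
  open import Data.List.Membership.Propositional using (lose)
  open import Data.List.Membership.Propositional.Properties using (∈-lookup; ∈-filter⁺; ∈-allFin)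
  open import Data.Nat
    using (ℕ; zero; suc; 2+; pred; _+_; _*_; _^_; _∸_; _≤_; _<_; _≤?_; _<?_; z≤n; s≤s; _!; >-nonZero)
  open import Data.Nat.Properties hiding (_≟_)
  open import Algebra.Properties.CommutativeSemigroup *-commutativeSemigroup
    using () renaming (x∙yz≈y∙xz to x*yz≡y*xz)
  open import Algebra.Properties.CommutativeSemigroup +-commutativeSemigroup
    using () renaming (x∙yz≈y∙xz to x+yz≡y+xz)
  open import Algebra.Properties.Semiring.Sum +-*-semiring
    using (sum; sum-syntax; sum-cong-≗; ∑-distrib-+; ∑-comm; *-distribˡ-sum; *-distribʳ-sum; sum-remove)
  open import Data.Nat.Tactic.RingSolver using (solve-∀)
  open import Data.Product using (∃; _×_; _,_; proj₁; proj₂)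
  open import Data.Sum using (_⊎_; inj₁; inj₂)
  open import Data.Vec using ([]; _∷_; here; there; lookup)
  open import Data.Vec.Properties using (≡-dec; []=⇒lookup; lookup⇒[]=)
  open import Data.Vec.Functional using (head; tail; removeAt) renaming (_∷_ to _∷ᶠ_)
  open import Function using (_∘_)
  open import Function.Bundles using (_⇔_; mk⇔; module Equivalence)
  import Function.Properties.Equivalence as ⇔
  open import Relation.Binary.PropositionalEquality
  open import Relation.Nullary using (¬_; Dec; does; yes; no; contradiction)
  open import Relation.Nullary.Decidable
    using (_×-dec_; ⌊_⌋; T?; toWitness; fromWitness; does-⇔; dec-true; dec-false)

  open import Defs

  ∑-const : ∀ m x → ∑[ i < m ] x ≡ m * x
  ∑-const zero    x = refl
  ∑-const (suc m) x = cong (x +_) (∑-const m x)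

  ∑-mono-≤ : ∀ {m} {f g : Fin m → ℕ} → (∀ i → f i ≤ g i) → sum f ≤ sum g
  ∑-mono-≤ {zero}  _   = z≤n
  ∑-mono-≤ {suc m} f≤g = +-mono-≤ (f≤g zero) (∑-mono-≤ (f≤g ∘ suc))

  term≤sum : ∀ {m} (f : Fin m → ℕ) i → f i ≤ sum f
  term≤sum f zero    = m≤m+n (f zero) _
  term≤sum f (suc i) = ≤-trans (term≤sum (f ∘ suc) i) (m≤n+m _ (f zero))

  sum≤*largest : ∀ {m} (f : Fin (suc m) → ℕ) → ∃ λ i → sum f ≤ suc m * f i
  sum≤*largest {zero}  f = zero , ≤-refl
  sum≤*largest {suc m} f with sum≤*largest (f ∘ suc)
  ... | i , le with f zero ≤? f (suc i)
  ...   | yes f₀≤fᵢ = suc i , +-mono-≤ f₀≤fᵢ le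
  ...   | no  f₀≰fᵢ = zero , +-monoʳ-≤ (f zero) (≤-trans le (*-monoʳ-≤ (suc m) (<⇒≤ (≰⇒> f₀≰fᵢ))))

  sum-at-zero : ∀ {m} (h : Fin (suc m) → ℕ) → (∀ i → h (suc i) ≡ 0) → sum h ≡ h zero
  sum-at-zero {m} h h≡0 =
    trans (cong (h zero +_) (trans (sum-cong-≗ h≡0) (trans (∑-const m 0) (*-zeroʳ m)))) (+-identityʳ _)

  sum-agree-off : ∀ {m} (h K : Fin (suc m) → ℕ) a → (∀ b → b ≢ a → h b ≡ K b) → sum h + K a ≡ sum K + h a
  sum-agree-off h K a agree = begin
    sum h + K a                      ≡⟨ cong (_+ K a) (sum-remove {i = a} h) ⟩
    h a + sum (removeAt h a) + K a   ≡⟨ cong (λ s → h a + s + K a) (sum-cong-≗ λ j → agree _ (F.punchInᵢ≢i a j)) ⟩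
    h a + sum (removeAt K a) + K a   ≡⟨ lemma (h a) (sum (removeAt K a)) (K a) ⟩
    K a + sum (removeAt K a) + h a   ≡⟨ cong (_+ h a) (sum-remove {i = a} K) ⟨
    sum K + h a                      ∎
    where
    open ≡-Reasoning
    lemma : ∀ x s y → x + s + y ≡ y + s + x
    lemma = solve-∀

  -- Unlike updateAt from Data.Vec.Functional, this reduces on the head of the function, as
  -- sumMaps-update needs.
  infixl 6 _[_]≔_
  _[_]≔_ : ∀ {n} {A : Set} → (Fin n → A) → Fin n → A → Fin n → A
  x [ zero  ]≔ a = a ∷ᶠ tail x
  x [ suc i ]≔ a = head x ∷ᶠ (tail x [ i ]≔ a)

  []≔-updates : ∀ {n} {A : Set} (x : Fin n → A) i a → (x [ i ]≔ a) i ≡ a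
  []≔-updates x zero    a = refl
  []≔-updates x (suc i) a = []≔-updates (tail x) i a

  []≔-minimal : ∀ {n} {A : Set} (x : Fin n → A) {i} a j → j ≢ i → (x [ i ]≔ a) j ≡ x j
  []≔-minimal x {zero}  a zero    j≢i = contradiction refl j≢i
  []≔-minimal x {zero}  a (suc j) j≢i = refl
  []≔-minimal x {suc i} a zero    j≢i = refl
  []≔-minimal x {suc i} a (suc j) j≢i = []≔-minimal (tail x) a j (j≢i ∘ cong suc)

  []≔-idem : ∀ {n} {A : Set} (x : Fin n → A) i a c j → (x [ i ]≔ a [ i ]≔ c) j ≡ (x [ i ]≔ c) j
  []≔-idem x i a c j with j F.≟ i
  ... | yes refl = trans ([]≔-updates _ j c) (sym ([]≔-updates x j c))
  ... | no  j≢i  = trans ([]≔-minimal _ c j j≢i) (trans ([]≔-minimal x a j j≢i) (sym ([]≔-minimal x c j j≢i)))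

  []≔-agree : ∀ {n} {A : Set} {x x′ : Fin n → A} {w} → (∀ j → j ≢ w → x j ≡ x′ j) →
    ∀ i a j → j ≢ w → (x [ i ]≔ a) j ≡ (x′ [ i ]≔ a) j
  []≔-agree {x = x} {x′} agree i a j j≢w with j F.≟ i
  ... | yes refl = trans ([]≔-updates x j a) (sym ([]≔-updates x′ j a))
  ... | no  j≢i  = trans ([]≔-minimal x a j j≢i) (trans (agree j j≢w) (sym ([]≔-minimal x′ a j j≢i)))

  []≔-cong : ∀ {n} {A : Set} {x x′ : Fin n → A} → (∀ j → x j ≡ x′ j) → ∀ i a j → (x [ i ]≔ a) j ≡ (x′ [ i ]≔ a) j
  []≔-cong {x = x} {x′} x≗x′ i a j with j F.≟ i
  ... | yes refl = trans ([]≔-updates x j a) (sym ([]≔-updates x′ j a))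
  ... | no  j≢i  = trans ([]≔-minimal x a j j≢i) (trans (x≗x′ j) (sym ([]≔-minimal x′ a j j≢i)))

  -- Sums over all maps between finite sets

  sumMaps : ∀ {r} n → ((Fin n → Fin r) → ℕ) → ℕ
  sumMaps zero    g = g (λ ())
  sumMaps (suc n) g = sum λ c → sumMaps n (λ x → g (c ∷ᶠ x))

  module _ {r : ℕ} where

    sumMaps-cong : ∀ n {g h : (Fin n → Fin r) → ℕ} → (∀ x → g x ≡ h x) → sumMaps n g ≡ sumMaps n h
    sumMaps-cong zero    g≡h = g≡h _
    sumMaps-cong (suc n) g≡h = sum-cong-≗ λ c → sumMaps-cong n (g≡h ∘ (c ∷ᶠ_))

    sumMaps-mono-≤ : ∀ n {g h : (Fin n → Fin r) → ℕ} → (∀ x → g x ≤ h x) → sumMaps n g ≤ sumMaps n h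
    sumMaps-mono-≤ zero    g≤h = g≤h _
    sumMaps-mono-≤ (suc n) g≤h = ∑-mono-≤ λ c → sumMaps-mono-≤ n (g≤h ∘ (c ∷ᶠ_))

    sumMaps-distrib-+ : ∀ n (g h : (Fin n → Fin r) → ℕ) →
      sumMaps n (λ x → g x + h x) ≡ sumMaps n g + sumMaps n h
    sumMaps-distrib-+ zero    g h = refl
    sumMaps-distrib-+ (suc n) g h = trans
      (sum-cong-≗ λ c → sumMaps-distrib-+ n (g ∘ (c ∷ᶠ_)) (h ∘ (c ∷ᶠ_)))
      (∑-distrib-+ (λ c → sumMaps n (g ∘ (c ∷ᶠ_))) (λ c → sumMaps n (h ∘ (c ∷ᶠ_))))

    sumMaps-const : ∀ n t → sumMaps n (λ (_ : Fin n → Fin r) → t) ≡ r ^ n * t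
    sumMaps-const zero    t = sym (+-identityʳ t)
    sumMaps-const (suc n) t = begin
      ∑[ _ < r ] sumMaps n (λ _ → t)   ≡⟨ sum-cong-≗ {r} (λ _ → sumMaps-const n t) ⟩
      ∑[ _ < r ] (r ^ n * t)          ≡⟨ ∑-const r _ ⟩
      r * (r ^ n * t)                 ≡⟨ *-assoc r (r ^ n) t ⟨
      r * r ^ n * t                   ∎
      where open ≡-Reasoning

    sumMaps-comm-∑ : ∀ n {m} (g : (Fin n → Fin r) → Fin m → ℕ) →
      sumMaps n (λ x → sum (g x)) ≡ sum (λ i → sumMaps n (λ x → g x i))
    sumMaps-comm-∑ zero    g = refl
    sumMaps-comm-∑ (suc n) g = trans
      (sum-cong-≗ λ c → sumMaps-comm-∑ n (g ∘ (c ∷ᶠ_)))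
      (∑-comm (λ c i → sumMaps n (λ x → g (c ∷ᶠ x) i)))

    sumMaps-update : ∀ n (i : Fin n) (G : (Fin n → Fin r) → ℕ) →
      sumMaps n (λ x → ∑[ a < r ] G (x [ i ]≔ a)) ≡ r * sumMaps n G
    sumMaps-update (suc n) zero    G = begin
      ∑[ _ < r ] sumMaps n (λ x → ∑[ a < r ] G (a ∷ᶠ x))  ≡⟨ ∑-const r _ ⟩
      r * sumMaps n (λ x → ∑[ a < r ] G (a ∷ᶠ x))         ≡⟨ cong (r *_) (sumMaps-comm-∑ n (λ x a → G (a ∷ᶠ x))) ⟩
      r * sumMaps (suc n) G                               ∎
      where open ≡-Reasoning
    sumMaps-update (suc n) (suc i) G = trans
      (sum-cong-≗ λ c → sumMaps-update n i (G ∘ (c ∷ᶠ_)))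
      (sym (*-distribˡ-sum r (λ c → sumMaps n (G ∘ (c ∷ᶠ_)))))

  sumMaps≤*largest : ∀ {r} n (g : (Fin n → Fin (suc r)) → ℕ) → ∃ λ x → sumMaps n g ≤ suc r ^ n * g x
  sumMaps≤*largest zero    g = (λ ()) , ≤-reflexive (sym (+-identityʳ _))
  sumMaps≤*largest {r} (suc n) g = c ∷ᶠ best c , (begin
      sum (λ c → sumMaps n (g ∘ (c ∷ᶠ_)))       ≤⟨ ∑-mono-≤ (λ c → proj₂ (sumMaps≤*largest n (g ∘ (c ∷ᶠ_)))) ⟩
      sum (λ c → suc r ^ n * value c)           ≡⟨ *-distribˡ-sum (suc r ^ n) value ⟨
      suc r ^ n * sum value                     ≤⟨ *-monoʳ-≤ (suc r ^ n) c-largest ⟩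
      suc r ^ n * (suc r * value c)             ≡⟨ *-assoc (suc r ^ n) (suc r) _ ⟨
      suc r ^ n * suc r * value c               ≡⟨ cong (_* value c) (*-comm (suc r ^ n) (suc r)) ⟩
      suc r * suc r ^ n * value c               ∎)
    where
    open ≤-Reasoning
    best : Fin (suc r) → Fin n → Fin (suc r)
    best c = proj₁ (sumMaps≤*largest n (g ∘ (c ∷ᶠ_)))
    value : Fin (suc r) → ℕ
    value c = g (c ∷ᶠ best c)
    c = proj₁ (sum≤*largest value)
    c-largest = proj₂ (sum≤*largest value)

  𝟙 : ∀ {A : Set} → Dec A → ℕ
  𝟙 d = if does d then 1 else 0

  𝟙-yes : ∀ {A : Set} (d : Dec A) → A → 𝟙 d ≡ 1
  𝟙-yes d a = cong (if_then 1 else 0) (dec-true d a)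

  𝟙-no : ∀ {A : Set} (d : Dec A) → ¬ A → 𝟙 d ≡ 0
  𝟙-no d ¬a = cong (if_then 1 else 0) (dec-false d ¬a)

  ∑∑-𝟙-zero : ∀ {m} {A : Set} (d : Dec A) →
    ∑[ a < suc m ] ∑[ b < suc m ] 𝟙 (a F.≟ zero ×-dec b F.≟ zero ×-dec d) ≡ 𝟙 d
  ∑∑-𝟙-zero {m} d = trans
    (sum-at-zero {m} (λ a → ∑[ b < suc m ] 𝟙 (a F.≟ zero ×-dec b F.≟ zero ×-dec d))
                 (λ _ → trans (∑-const (suc m) 0) (*-zeroʳ (suc m))))
    (sum-at-zero {m} (λ b → 𝟙 (b F.≟ zero ×-dec d)) (λ _ → refl))

  infix 4 _≟ₛ_
  _≟ₛ_ : ∀ {n} (p q : Subset n) → Dec (p ≡ q)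
  _≟ₛ_ = ≡-dec Bool._≟_

  suc∣p-x∣≡∣p∣ : ∀ {n} {x : Fin n} (p : Subset n) → x ∈ p → suc ∣ p - x ∣ ≡ ∣ p ∣
  suc∣p-x∣≡∣p∣ (inside  ∷ p) here        = cong (suc ∘ ∣_∣) (p─⊥≡p p)
  suc∣p-x∣≡∣p∣ (inside  ∷ p) (there x∈p) = cong suc (suc∣p-x∣≡∣p∣ p x∈p)
  suc∣p-x∣≡∣p∣ (outside ∷ p) (there x∈p) = suc∣p-x∣≡∣p∣ p x∈p

  x∈p-y⁻ : ∀ {n} {x y : Fin n} (p : Subset n) → x ∈ p - y → x ∈ p × x ≢ y
  x∈p-y⁻ {x = suc x} {zero}  (s ∷ p)      (there x∈p─⊥) = there (subst (x ∈_) (p─⊥≡p p) x∈p─⊥) , λ ()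
  x∈p-y⁻ {x = zero}  {suc y} (inside ∷ p) here            = here , λ ()
  x∈p-y⁻ {x = suc x} {suc y} (s ∷ p)      (there x∈p-y)  =
    let x∈p , x≢y = x∈p-y⁻ p x∈p-y in there x∈p , x≢y ∘ F.suc-injective

  ∣p∣>0⇒nonempty : ∀ {n} (p : Subset n) → 0 < ∣ p ∣ → Nonempty p
  ∣p∣>0⇒nonempty (inside  ∷ p) _   = zero , here
  ∣p∣>0⇒nonempty (outside ∷ p) 0<∣p∣ = let x , x∈p = ∣p∣>0⇒nonempty p 0<∣p∣ in suc x , there x∈p

  sum-const-on : ∀ {n} (U : Subset n) (h : Fin n → ℕ) X →
    (∀ c → c ∈ U → h c ≡ X) → (∀ c → c ∉ U → h c ≡ 0) → sum h ≡ ∣ U ∣ * X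
  sum-const-on []            h X _  _  = refl
  sum-const-on (inside  ∷ U) h X on off = cong₂ _+_ (on zero here)
    (sum-const-on U (h ∘ suc) X (λ c → on (suc c) ∘ there) (λ c c∉U → off (suc c) (c∉U ∘ drop-there)))
  sum-const-on (outside ∷ U) h X on off = cong₂ _+_ (off zero λ ())
    (sum-const-on U (h ∘ suc) X (λ c → on (suc c) ∘ there) (λ c c∉U → off (suc c) (c∉U ∘ drop-there)))

  ⁅⁆∪≡-count : ∀ {r} {c : Fin r} (W U : Subset r) → c ∈ U →
    𝟙 (⁅ c ⁆ ∪ W ≟ₛ U) ≡ 𝟙 (W ≟ₛ U) + 𝟙 (W ≟ₛ U - c)
  ⁅⁆∪≡-count (w ∷ W) (inside ∷ U) here
    rewrite ∪-identityˡ W with w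
  ... | inside  = sym (+-identityʳ _)
  ... | outside = cong (λ V → 𝟙 (W ≟ₛ V)) (sym (p─⊥≡p U))
  ⁅⁆∪≡-count (w ∷ W) (u ∷ U) (there c∈U) with does (w Bool.≟ u)
  ... | true  = ⁅⁆∪≡-count W U c∈U
  ... | false = refl

  ⁅⁆∪≢-count : ∀ {r} {c : Fin r} (W U : Subset r) → c ∉ U → 𝟙 (⁅ c ⁆ ∪ W ≟ₛ U) ≡ 0
  ⁅⁆∪≢-count {c = zero}  (w ∷ W) (inside  ∷ U) c∉U = contradiction here c∉U
  ⁅⁆∪≢-count {c = zero}  (w ∷ W) (outside ∷ U) c∉U = refl
  ⁅⁆∪≢-count {c = suc c} (w ∷ W) (u ∷ U)       c∉U with does (w Bool.≟ u)
  ... | true  = ⁅⁆∪≢-count W U (c∉U ∘ there)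
  ... | false = refl

  surjections : ℕ → ℕ → ℕ
  surjections k u = stirling2 k u * u !

  surjections-suc : ∀ k u → surjections (suc k) u ≡ u * (surjections k u + surjections k (pred u))
  surjections-suc k zero    = refl
  surjections-suc k (suc u) = lemma (suc u) (stirling2 k (suc u)) (stirling2 k u) (u !)
    where
    lemma : ∀ a s t f → (a * s + t) * (a * f) ≡ a * (s * (a * f) + t * f)
    lemma = solve-∀

  0<stirling2-diag : ∀ a → 0 < stirling2 a a
  0<stirling2-diag zero    = s≤s z≤n
  0<stirling2-diag (suc a) = ≤-trans (0<stirling2-diag a) (m≤n+m _ _)

  0<stirling2 : ∀ {a b} → b ≤ a → 0 < stirling2 (suc a) (suc b)
  0<stirling2 {a} b≤a with m≤n⇒m<n∨m≡n b≤a
  0<stirling2 {a}     {b} b≤a | inj₂ refl         = 0<stirling2-diag (suc a)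
  0<stirling2 {suc a} {b} b≤a | inj₁ (s≤s b≤a′) =
    ≤-trans (0<stirling2 b≤a′) (≤-trans (m≤n*m _ (suc b)) (m≤m+n _ _))

  0<surjections : ∀ {k u} → 0 < stirling2 k u → 0 < surjections k u
  0<surjections {u = u} 0<S = *-mono-< 0<S (1≤n! u)

  image : ∀ {n r} → Subset n → (Fin n → Fin r) → Subset r
  image []            x = ⊥
  image (outside ∷ e) x = image e (tail x)
  image (inside  ∷ e) x = ⁅ head x ⁆ ∪ image e (tail x)

  image-empty-count : ∀ {r} (U : Subset r) → 𝟙 (⊥ ≟ₛ U) ≡ surjections 0 ∣ U ∣
  image-empty-count []            = refl
  image-empty-count (inside  ∷ U) = refl
  image-empty-count (outside ∷ U) = image-empty-count U

  module _ {r : ℕ} where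

    -- There are surjections ∣ e ∣ ∣ U ∣ * r ^ (n ∸ ∣ e ∣) maps with image U on e; multiplying by
    -- r ^ ∣ e ∣ avoids the subtraction.
    count-image : ∀ n (e : Subset n) (U : Subset r) →
      r ^ ∣ e ∣ * sumMaps n (λ x → 𝟙 (image e x ≟ₛ U)) ≡ surjections ∣ e ∣ ∣ U ∣ * r ^ n
    count-image zero [] U = begin
      𝟙 (⊥ ≟ₛ U) + 0           ≡⟨ +-identityʳ _ ⟩
      𝟙 (⊥ ≟ₛ U)               ≡⟨ image-empty-count U ⟩
      surjections 0 ∣ U ∣      ≡⟨ *-identityʳ _ ⟨
      surjections 0 ∣ U ∣ * 1  ∎
      where open ≡-Reasoning
    count-image (suc n) (outside ∷ e) U = begin
      r ^ ∣ e ∣ * ∑[ _ < r ] S                 ≡⟨ cong (r ^ ∣ e ∣ *_) (∑-const r S) ⟩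
      r ^ ∣ e ∣ * (r * S)                      ≡⟨ x*yz≡y*xz (r ^ ∣ e ∣) r S ⟩
      r * (r ^ ∣ e ∣ * S)                      ≡⟨ cong (r *_) (count-image n e U) ⟩
      r * (surjections ∣ e ∣ ∣ U ∣ * r ^ n)    ≡⟨ x*yz≡y*xz r (surjections ∣ e ∣ ∣ U ∣) (r ^ n) ⟩
      surjections ∣ e ∣ ∣ U ∣ * (r * r ^ n)    ∎
      where
      open ≡-Reasoning
      S = sumMaps n (λ x → 𝟙 (image e x ≟ₛ U))
    count-image (suc n) (inside ∷ e) U = begin
      r * r ^ ∣ e ∣ * ∑[ c < r ] N c              ≡⟨ *-assoc r (r ^ ∣ e ∣) _ ⟩
      r * (r ^ ∣ e ∣ * ∑[ c < r ] N c)            ≡⟨ cong (r *_) (*-distribˡ-sum (r ^ ∣ e ∣) N) ⟩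
      r * ∑[ c < r ] (r ^ ∣ e ∣ * N c)            ≡⟨ cong (r *_) (sum-const-on U _ ((A + B) * r ^ n) on off) ⟩
      r * (∣ U ∣ * ((A + B) * r ^ n))             ≡⟨ lemma r ∣ U ∣ (A + B) (r ^ n) ⟩
      ∣ U ∣ * (A + B) * (r * r ^ n)               ≡⟨ cong (_* (r * r ^ n)) (surjections-suc ∣ e ∣ ∣ U ∣) ⟨
      surjections (suc ∣ e ∣) ∣ U ∣ * (r * r ^ n) ∎
      where
      open ≡-Reasoning
      N : Fin r → ℕ
      N c = sumMaps n (λ x → 𝟙 (⁅ c ⁆ ∪ image e x ≟ₛ U))
      A = surjections ∣ e ∣ ∣ U ∣
      B = surjections ∣ e ∣ (pred ∣ U ∣)
      lemma : ∀ a u s f → a * (u * (s * f)) ≡ u * s * (a * f)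
      lemma = solve-∀
      on : ∀ c → c ∈ U → r ^ ∣ e ∣ * N c ≡ (A + B) * r ^ n
      on c c∈U = begin
        r ^ ∣ e ∣ * N c
          ≡⟨ cong (r ^ ∣ e ∣ *_) (sumMaps-cong n (λ x → ⁅⁆∪≡-count (image e x) U c∈U)) ⟩
        r ^ ∣ e ∣ * sumMaps n (λ x → 𝟙 (image e x ≟ₛ U) + 𝟙 (image e x ≟ₛ U - c))
          ≡⟨ cong (r ^ ∣ e ∣ *_) (sumMaps-distrib-+ n _ _) ⟩
        r ^ ∣ e ∣ * (sumMaps n (λ x → 𝟙 (image e x ≟ₛ U)) + sumMaps n (λ x → 𝟙 (image e x ≟ₛ U - c)))
          ≡⟨ *-distribˡ-+ (r ^ ∣ e ∣) _ _ ⟩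
        r ^ ∣ e ∣ * sumMaps n (λ x → 𝟙 (image e x ≟ₛ U)) + r ^ ∣ e ∣ * sumMaps n (λ x → 𝟙 (image e x ≟ₛ U - c))
          ≡⟨ cong₂ _+_ (count-image n e U) (count-image n e (U - c)) ⟩
        A * r ^ n + surjections ∣ e ∣ ∣ U - c ∣ * r ^ n
          ≡⟨ cong (λ u → A * r ^ n + surjections ∣ e ∣ u * r ^ n) (cong pred (suc∣p-x∣≡∣p∣ U c∈U)) ⟩
        A * r ^ n + B * r ^ n
          ≡⟨ *-distribʳ-+ (r ^ n) A B ⟨
        (A + B) * r ^ n ∎
      off : ∀ c → c ∉ U → r ^ ∣ e ∣ * N c ≡ 0
      off c c∉U = begin
        r ^ ∣ e ∣ * N c
          ≡⟨ cong (r ^ ∣ e ∣ *_) (sumMaps-cong n (λ x → ⁅⁆∪≢-count (image e x) U c∉U)) ⟩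
        r ^ ∣ e ∣ * sumMaps n (λ _ → 0)
          ≡⟨ cong (r ^ ∣ e ∣ *_) (trans (sumMaps-const n 0) (*-zeroʳ (r ^ n))) ⟩
        r ^ ∣ e ∣ * 0
          ≡⟨ *-zeroʳ (r ^ ∣ e ∣) ⟩
        0 ∎

  ∈-image⁺ : ∀ {n r} {w : Fin n} (e : Subset n) (x : Fin n → Fin r) → w ∈ e → x w ∈ image e x
  ∈-image⁺ (inside  ∷ e) x here        = x∈p∪q⁺ (inj₁ (x∈⁅x⁆ (x zero)))
  ∈-image⁺ (inside  ∷ e) x (there w∈e) = x∈p∪q⁺ (inj₂ (∈-image⁺ e (tail x) w∈e))
  ∈-image⁺ (outside ∷ e) x (there w∈e) = ∈-image⁺ e (tail x) w∈e

  ∈-image⁻ : ∀ {n r} {i : Fin r} (e : Subset n) (x : Fin n → Fin r) →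
    i ∈ image e x → ∃ λ w → w ∈ e × x w ≡ i
  ∈-image⁻ []            x i∈ = contradiction i∈ ∉⊥
  ∈-image⁻ (outside ∷ e) x i∈ with ∈-image⁻ e (tail x) i∈
  ... | w , w∈e , xw≡i = suc w , there w∈e , xw≡i
  ∈-image⁻ (inside  ∷ e) x i∈ with x∈p∪q⁻ ⁅ x zero ⁆ (image e (tail x)) i∈
  ... | inj₁ i∈⁅x₀⁆ = zero , here , sym (x∈⁅y⁆⇒x≡y (x zero) i∈⁅x₀⁆)
  ... | inj₂ i∈img with ∈-image⁻ e (tail x) i∈img
  ...   | w , w∈e , xw≡i = suc w , there w∈e , xw≡i

  image-cong : ∀ {n r} (e : Subset n) {x y : Fin n → Fin r} →
    (∀ w → w ∈ e → x w ≡ y w) → image e x ≡ image e y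
  image-cong []            x≡y = refl
  image-cong (outside ∷ e) x≡y = image-cong e (λ w → x≡y (suc w) ∘ there)
  image-cong (inside  ∷ e) x≡y =
    cong₂ (λ c W → ⁅ c ⁆ ∪ W) (x≡y zero here) (image-cong e (λ w → x≡y (suc w) ∘ there))

  SurjectiveOn : ∀ {n r} → Subset n → (Fin n → Fin r) → Set
  SurjectiveOn e x = ∀ i → ∃ λ w → w ∈ e × x w ≡ i

  image≡⊤⇔surjectiveOn : ∀ {n r} (e : Subset n) (x : Fin n → Fin r) → image e x ≡ ⊤ ⇔ SurjectiveOn e x
  image≡⊤⇔surjectiveOn e x = mk⇔
    (λ img≡⊤ i → ∈-image⁻ e x (subst (i ∈_) (sym img≡⊤) ∈⊤))
    (λ surj → ⊆-antisym ⊆⊤ λ {i} _ → let w , w∈e , xw≡i = surj i in subst (_∈ image e x) xw≡i (∈-image⁺ e x w∈e))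

  meetsAll⇔surjectiveOn : ∀ {n r} (e : Subset n) (x : Fin n → Fin r) → T (meetsAll x e) ⇔ SurjectiveOn e x
  meetsAll⇔surjectiveOn {n} {r} e x = mk⇔ to from
    where
    hit : Fin r → Fin n → Bool
    hit i v = lookup e v ∧ ⌊ x v F.≟ i ⌋
    to : T (meetsAll x e) → SurjectiveOn e x
    to meets i =
      let v , hitᵥ = Any.tabulate⁻ (any⁻ (hit i) (allFin n) (All.tabulate⁻ (all⁺ _ (allFin r) meets) i))
          v∈e , xv≡i = Equivalence.to T-∧ hitᵥ
      in v , lookup⇒[]= v e (Equivalence.to T-≡ v∈e) , toWitness xv≡i
    from : SurjectiveOn e x → T (meetsAll x e)
    from surj = all⁻ _ (All.tabulate⁺ λ i →
      let w , w∈e , xw≡i = surj i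
      in any⁺ (hit i) (Any.tabulate⁺ w (Equivalence.from T-∧
           (Equivalence.from T-≡ ([]=⇒lookup w∈e) , fromWitness xw≡i))))

  meetsAll≡image≡⊤ : ∀ {n r} (x : Fin n → Fin r) (e : Subset n) → meetsAll x e ≡ does (image e x ≟ₛ ⊤)
  meetsAll≡image≡⊤ x e = does-⇔
    (⇔.trans (meetsAll⇔surjectiveOn e x) (⇔.sym (image≡⊤⇔surjectiveOn e x)))
    (T? (meetsAll x e)) (image e x ≟ₛ ⊤)

  meets : ∀ {n r} → Subset n → (Fin n → Fin r) → ℕ
  meets e x = 𝟙 (image e x ≟ₛ ⊤)

  meets-cong : ∀ {n r} (e : Subset n) {x y : Fin n → Fin r} →
    (∀ w → w ∈ e → x w ≡ y w) → meets e x ≡ meets e y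
  meets-cong e x≡y = cong (λ U → 𝟙 (U ≟ₛ ⊤)) (image-cong e x≡y)

  meets-mono : ∀ {n r} (e : Subset n) {y z : Fin n → Fin r} →
    (∀ w → w ∈ e → ∃ λ w′ → w′ ∈ e × z w′ ≡ y w) → meets e y ≤ meets e z
  meets-mono e {y} {z} z-covers-y with image e y ≟ₛ ⊤
  ... | no  _      = z≤n
  ... | yes img≡⊤ = ≤-reflexive (sym (𝟙-yes (image e z ≟ₛ ⊤) (Equivalence.from (image≡⊤⇔surjectiveOn e z) surj-z)))
    where
    surj-z : SurjectiveOn e z
    surj-z i =
      let w  , w∈e  , yw≡i  = Equivalence.to (image≡⊤⇔surjectiveOn e y) img≡⊤ i
          w′ , w′∈e , zw′≡yw = z-covers-y w w∈e
      in w′ , w′∈e , trans zw′≡yw yw≡i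

  length-filterᵇ : ∀ {A : Set} (p : A → Bool) (xs : List A) →
    length (filterᵇ p xs) ≡ ∑[ i < length xs ] 𝟙 (T? (p (List.lookup xs i)))
  length-filterᵇ p []       = refl
  length-filterᵇ p (x ∷ xs) with p x
  ... | true  = cong suc (length-filterᵇ p xs)
  ... | false = length-filterᵇ p xs

  edge : ∀ {k n} (H : MultiHypergraph k n) → Fin (numEdges H) → Subset n
  edge H = List.lookup (edges H)

  ∣edge∣≡k : ∀ {k n} (H : MultiHypergraph k n) i → ∣ edge H i ∣ ≡ k
  ∣edge∣≡k H i = All.lookup (uniform H) (∈-lookup i)

  cutSize≡∑meets : ∀ {k n r} (H : MultiHypergraph k n) (x : Cut n r) →
    cutSize H x ≡ ∑[ i < numEdges H ] meets (edge H i) x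
  cutSize≡∑meets H x = trans (length-filterᵇ (meetsAll x) (edges H))
    (sum-cong-≗ λ i → cong (if_then 1 else 0) (meetsAll≡image≡⊤ x (edge H i)))

  sumMaps-meets : ∀ {r} n (e : Subset n) → r ^ ∣ e ∣ * sumMaps n (meets {r = r} e) ≡ surjections ∣ e ∣ r * r ^ n
  sumMaps-meets {r} n e = trans (count-image n e ⊤) (cong (λ u → surjections ∣ e ∣ u * r ^ n) (∣⊤∣≡n r))

  -- Moving a vertex off a given part

  rotate : ∀ {m} → Fin (suc m) → Fin (suc m)
  rotate {zero}  zero    = zero
  rotate {suc m} zero    = suc zero
  rotate {suc m} (suc i) = F.punchIn (suc zero) (rotate i)

  sum-∘-rotate : ∀ {m} (h : Fin (suc m) → ℕ) → sum (h ∘ rotate) ≡ sum h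
  sum-∘-rotate {zero}  h = refl
  sum-∘-rotate {suc m} h = begin
    h (suc zero) + ∑[ i < suc m ] h (F.punchIn (suc zero) (rotate i))
      ≡⟨ cong (h (suc zero) +_) (sum-∘-rotate (h ∘ F.punchIn (suc zero))) ⟩
    h (suc zero) + (h zero + ∑[ i < m ] h (suc (suc i)))
      ≡⟨ x+yz≡y+xz (h (suc zero)) (h zero) _ ⟩
    h zero + (h (suc zero) + ∑[ i < m ] h (suc (suc i))) ∎
    where open ≡-Reasoning

  avoid : ∀ {m} → Fin (suc m) → Fin (suc m) → Fin (suc m)
  avoid a b = if does (b F.≟ a) then rotate a else b

  avoid-≢ : ∀ {m} {a b : Fin (suc m)} → b ≢ a → avoid a b ≡ b
  avoid-≢ {a = a} {b} b≢a = cong (if_then rotate a else b) (dec-false (b F.≟ a) b≢a)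

  avoid-≡ : ∀ {m} (a : Fin (suc m)) → avoid a a ≡ rotate a
  avoid-≡ a = cong (if_then rotate a else a) (dec-true (a F.≟ a) refl)

  ∑∑-avoid : ∀ {m} (K : Fin (suc m) → ℕ) →
    ∑[ a < suc m ] ∑[ b < suc m ] K (avoid a b) ≡ ∑[ a < suc m ] ∑[ b < suc m ] K b
  ∑∑-avoid {m} K = +-cancelʳ-≡ (sum K) _ _ (begin
    ∑[ a < suc m ] ∑[ b < suc m ] K (avoid a b) + sum K
      ≡⟨ ∑-distrib-+ (λ a → ∑[ b < suc m ] K (avoid a b)) K ⟨
    ∑[ a < suc m ] (∑[ b < suc m ] K (avoid a b) + K a)
      ≡⟨ sum-cong-≗ (λ a → sum-agree-off _ K a (λ b → cong K ∘ avoid-≢)) ⟩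
    ∑[ a < suc m ] (sum K + K (avoid a a))
      ≡⟨ ∑-distrib-+ (λ _ → sum K) (λ a → K (avoid a a)) ⟩
    ∑[ a < suc m ] sum K + ∑[ a < suc m ] K (avoid a a)
      ≡⟨ cong (∑[ a < suc m ] sum K +_) (trans (sum-cong-≗ (cong K ∘ avoid-≡)) (sum-∘-rotate K)) ⟩
    ∑[ a < suc m ] sum K + sum K ∎)
    where open ≡-Reasoning

  Admissible : ∀ {r} → Subset (2+ r) → Set
  Admissible U = suc zero ∉ U × (∀ i → i ≢ zero → i ≢ suc zero → i ∈ U)

  admissible-⊤-0-1 : ∀ r → Admissible (⊤ {2+ r} - zero - suc zero)
  admissible-⊤-0-1 r = 1∉ , λ i i≢0 i≢1 → x∈p∧x≢y⇒x∈p-y (x∈p∧x≢y⇒x∈p-y ∈⊤ i≢0) i≢1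
    where
    1∉ : suc zero ∉ ⊤ {2+ r} - zero - suc zero
    1∉ 1∈ = proj₂ (x∈p-y⁻ (⊤ - zero) 1∈) refl

  admissible-⊤-1 : ∀ r → Admissible (⊤ {2+ r} - suc zero)
  admissible-⊤-1 r = (λ 1∈ → proj₂ (x∈p-y⁻ ⊤ 1∈) refl) , λ i _ i≢1 → x∈p∧x≢y⇒x∈p-y ∈⊤ i≢1

  ∣⊤-0-1∣≡r : ∀ r → ∣ ⊤ {2+ r} - zero - suc zero ∣ ≡ r
  ∣⊤-0-1∣≡r r = suc-injective (suc-injective (begin
    2+ ∣ ⊤ {2+ r} - zero - suc zero ∣
      ≡⟨ cong suc (suc∣p-x∣≡∣p∣ {x = suc zero} (⊤ {2+ r} - zero) (x∈p∧x≢y⇒x∈p-y {y = zero} ∈⊤ λ ())) ⟩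
    suc ∣ ⊤ {2+ r} - zero ∣
      ≡⟨ suc∣p-x∣≡∣p∣ {x = zero} (⊤ {2+ r}) ∈⊤ ⟩
    ∣ ⊤ {2+ r} ∣
      ≡⟨ ∣⊤∣≡n (2+ r) ⟩
    2+ r ∎))
    where open ≡-Reasoning

  ∣⊤-1∣≡1+r : ∀ r → ∣ ⊤ {2+ r} - suc zero ∣ ≡ suc r
  ∣⊤-1∣≡1+r r = suc-injective (trans (suc∣p-x∣≡∣p∣ {x = suc zero} (⊤ {2+ r}) ∈⊤) (∣⊤∣≡n (2+ r)))

  admissible-with-surjections : ∀ {r k} → r ≤ k → ∃ λ U → Admissible {r} U × 0 < surjections k ∣ U ∣
  admissible-with-surjections {r} {k} r≤k with m≤n⇒m<n∨m≡n r≤k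
  ... | inj₂ refl = ⊤ - zero - suc zero , admissible-⊤-0-1 r ,
    subst (λ u → 0 < surjections r u) (sym (∣⊤-0-1∣≡r r)) (0<surjections {r} {r} (0<stirling2-diag r))
  admissible-with-surjections {r} {suc k} r≤k | inj₁ (s≤s r≤k′) = ⊤ - suc zero , admissible-⊤-1 r ,
    subst (λ u → 0 < surjections (suc k) u) (sym (∣⊤-1∣≡1+r r)) (0<surjections {suc k} {suc r} (0<stirling2 r≤k′))

  -- Separating the pairs of an involution

  module Fixing {n r : ℕ} (σ : Fin n → Fin n) (σ-involutive : ∀ w → σ (σ w) ≡ w) where

    Colouring : Set
    Colouring = Cut n (2+ r)

    -- Each pair {σ v, v} with σ v ≢ v is handled once, at its larger element v.
    Upper : Fin n → Set
    Upper v = toℕ (σ v) < toℕ v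

    upper⇒σ≢ : ∀ {v} → Upper v → σ v ≢ v
    upper⇒σ≢ upᵥ σv≡v = <-irrefl (cong toℕ σv≡v) upᵥ

    σ-injective : ∀ {v w} → σ w ≡ σ v → w ≡ v
    σ-injective {v} {w} eq = trans (sym (σ-involutive w)) (trans (cong σ eq) (σ-involutive v))

    upper⇒≢σ : ∀ {v w} → Upper v → Upper w → w ≢ σ v
    upper⇒≢σ {v} upᵥ upw refl rewrite σ-involutive v = <-asym upᵥ upw

    upper⇒σ≢′ : ∀ {v w} → Upper v → Upper w → σ w ≢ v
    upper⇒σ≢′ {v} {w} upᵥ upw σw≡v = upper⇒≢σ upᵥ upw (trans (sym (σ-involutive w)) (cong σ σw≡v))

    fix : Fin n → Colouring → Colouring
    fix v y = y [ v ]≔ avoid (y (σ v)) (y v)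

    fixAll : List (Fin n) → Colouring → Colouring
    fixAll []      y = y
    fixAll (v ∷ L) y = fix v (fixAll L y)

    fix-minimal : ∀ v (y : Colouring) j → j ≢ v → fix v y j ≡ y j
    fix-minimal v y j = []≔-minimal y _ j

    fix-updates : ∀ v (y : Colouring) → fix v y v ≡ avoid (y (σ v)) (y v)
    fix-updates v y = []≔-updates y v _

    fix-cong : ∀ v {y y′ : Colouring} → (∀ j → y j ≡ y′ j) → ∀ j → fix v y j ≡ fix v y′ j
    fix-cong v {y} {y′} y≗y′ j =
      trans ([]≔-cong y≗y′ v _ j) (cong (λ c → (y′ [ v ]≔ c) j) (cong₂ avoid (y≗y′ (σ v)) (y≗y′ v)))

    pair-minimal : ∀ (y : Colouring) v a b j → j ≢ v → j ≢ σ v → (y [ σ v ]≔ a [ v ]≔ b) j ≡ y j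
    pair-minimal y v a b j j≢v j≢σv = trans ([]≔-minimal _ b j j≢v) ([]≔-minimal y a j j≢σv)

    pair-σ : ∀ (y : Colouring) v a b → σ v ≢ v → (y [ σ v ]≔ a [ v ]≔ b) (σ v) ≡ a
    pair-σ y v a b σv≢v = trans ([]≔-minimal _ b (σ v) σv≢v) ([]≔-updates y (σ v) a)

    fix-pair : ∀ {v} → Upper v → ∀ y a b j → fix v (y [ σ v ]≔ a [ v ]≔ b) j ≡ (y [ σ v ]≔ a [ v ]≔ avoid a b) j
    fix-pair {v} upᵥ y a b j = begin
      (P [ v ]≔ avoid (P (σ v)) (P v)) j
        ≡⟨ cong (λ c → (P [ v ]≔ c) j) (cong₂ avoid (pair-σ y v a b (upper⇒σ≢ upᵥ)) ([]≔-updates _ v b)) ⟩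
      (P [ v ]≔ avoid a b) j
        ≡⟨ []≔-idem _ v b (avoid a b) j ⟩
      (y [ σ v ]≔ a [ v ]≔ avoid a b) j ∎
      where
      open ≡-Reasoning
      P = y [ σ v ]≔ a [ v ]≔ b

    fix-comm-pair : ∀ {v w} → Upper v → Upper w → w ≢ v → ∀ y a b j →
      fix w (y [ σ v ]≔ a [ v ]≔ b) j ≡ (fix w y [ σ v ]≔ a [ v ]≔ b) j
    fix-comm-pair {v} {w} upᵥ upw w≢v y a b j with j F.≟ w
    ... | yes refl = begin
      fix j P j                          ≡⟨ fix-updates j P ⟩
      avoid (P (σ j)) (P j)              ≡⟨ cong₂ avoid (pair-minimal y v a b (σ j) (upper⇒σ≢′ upᵥ upw) (w≢v ∘ σ-injective))
                                                        (pair-minimal y v a b j w≢v (upper⇒≢σ upᵥ upw)) ⟩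
      avoid (y (σ j)) (y j)              ≡⟨ fix-updates j y ⟨
      fix j y j                          ≡⟨ pair-minimal (fix j y) v a b j w≢v (upper⇒≢σ upᵥ upw) ⟨
      (fix j y [ σ v ]≔ a [ v ]≔ b) j    ∎
      where
      open ≡-Reasoning
      P = y [ σ v ]≔ a [ v ]≔ b
    ... | no j≢w = trans (fix-minimal w _ j j≢w)
      ([]≔-agree ([]≔-agree (λ j′ j′≢w → sym (fix-minimal w y j′ j′≢w)) (σ v) a) v b j j≢w)

    fixAll-comm-pair : ∀ {v} L → Upper v → All.All (v ≢_) L → All.All Upper L → ∀ y a b j →
      fixAll L (y [ σ v ]≔ a [ v ]≔ b) j ≡ (fixAll L y [ σ v ]≔ a [ v ]≔ b) j
    fixAll-comm-pair []      upᵥ All.[]             All.[]             y a b j = refl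
    fixAll-comm-pair (w ∷ L) upᵥ (v≢w All.∷ v≢L) (upw All.∷ upL) y a b j =
      trans (fix-cong w (fixAll-comm-pair L upᵥ v≢L upL y a b) j) (fix-comm-pair upᵥ upw (≢-sym v≢w) (fixAll L y) a b j)

    fix-comm : ∀ {v w} → Upper v → Upper w → w ≢ v → ∀ y j → fix w (fix v y) j ≡ fix v (fix w y) j
    fix-comm {v} {w} upᵥ upw w≢v y j with j F.≟ w | j F.≟ v
    ... | yes refl | yes refl = contradiction refl w≢v
    ... | yes refl | no  j≢v  = begin
      fix j (fix v y) j
        ≡⟨ fix-updates j (fix v y) ⟩
      avoid (fix v y (σ j)) (fix v y j)
        ≡⟨ cong₂ avoid (fix-minimal v y (σ j) (upper⇒σ≢′ upᵥ upw)) (fix-minimal v y j j≢v) ⟩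
      avoid (y (σ j)) (y j)
        ≡⟨ fix-updates j y ⟨
      fix j y j
        ≡⟨ fix-minimal v (fix j y) j j≢v ⟨
      fix v (fix j y) j ∎
      where open ≡-Reasoning
    ... | no  j≢w  | yes refl = begin
      fix w (fix j y) j
        ≡⟨ fix-minimal w (fix j y) j j≢w ⟩
      fix j y j
        ≡⟨ fix-updates j y ⟩
      avoid (y (σ j)) (y j)
        ≡⟨ cong₂ avoid (fix-minimal w y (σ j) (upper⇒σ≢′ upw upᵥ)) (fix-minimal w y j j≢w) ⟨
      avoid (fix w y (σ j)) (fix w y j)
        ≡⟨ fix-updates j (fix w y) ⟨
      fix j (fix w y) j ∎
      where open ≡-Reasoning
    ... | no  j≢w  | no  j≢v  = begin
      fix w (fix v y) j  ≡⟨ fix-minimal w (fix v y) j j≢w ⟩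
      fix v y j          ≡⟨ fix-minimal v y j j≢v ⟩
      y j                ≡⟨ fix-minimal w y j j≢w ⟨
      fix w y j          ≡⟨ fix-minimal v (fix w y) j j≢v ⟨
      fix v (fix w y) j  ∎
      where open ≡-Reasoning

    sumMaps-pair : ∀ (G : Colouring → ℕ) v →
      sumMaps n (λ x → ∑[ a < 2+ r ] ∑[ b < 2+ r ] G (x [ σ v ]≔ a [ v ]≔ b)) ≡ 2+ r * (2+ r * sumMaps n G)
    sumMaps-pair G v = trans (sumMaps-update n (σ v) (λ x → ∑[ b < 2+ r ] G (x [ v ]≔ b)))
                             (cong (2+ r *_) (sumMaps-update n v G))

    module _ (e : Subset n) where

      Local : (Colouring → ℕ) → Set
      Local Γ = ∀ {x y} → (∀ w → w ∈ e → x w ≡ y w) → Γ x ≡ Γ y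

      Improves : (Colouring → ℕ) → Fin n → Set
      Improves Γ v = v ∈ e → σ v ∈ e → ∀ y → Γ y ≤ Γ (fix v y)

      -- Resample the parts a of σ v and b of v: Γ ignores a, and by ∑∑-avoid replacing b by
      -- avoid a b does not change the total.
      sumMaps-fix-σ∉ : ∀ Γ → Local Γ → ∀ L {v} → Upper v → All.All (v ≢_) L → All.All Upper L → σ v ∉ e →
        sumMaps n (Γ ∘ fix v ∘ fixAll L) ≡ sumMaps n (Γ ∘ fixAll L)
      sumMaps-fix-σ∉ Γ local L {v} upᵥ v≢L upL σv∉e = *-cancelˡ-≡ _ _ (2+ r) (*-cancelˡ-≡ _ _ (2+ r) (begin
        2+ r * (2+ r * sumMaps n (Γ ∘ fix v ∘ fixAll L))
          ≡⟨ sumMaps-pair (Γ ∘ fix v ∘ fixAll L) v ⟨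
        sumMaps n (λ x → ∑[ a < 2+ r ] ∑[ b < 2+ r ] Γ (fix v (fixAll L (x [ σ v ]≔ a [ v ]≔ b))))
          ≡⟨ sumMaps-cong n resample ⟩
        sumMaps n (λ x → ∑[ a < 2+ r ] ∑[ b < 2+ r ] Γ (fixAll L (x [ σ v ]≔ a [ v ]≔ b)))
          ≡⟨ sumMaps-pair (Γ ∘ fixAll L) v ⟩
        2+ r * (2+ r * sumMaps n (Γ ∘ fixAll L)) ∎))
        where
        open ≡-Reasoning
        forget-σ : ∀ y a c → Γ (y [ σ v ]≔ a [ v ]≔ c) ≡ Γ (y [ v ]≔ c)
        forget-σ y a c = local λ w w∈e →
          []≔-agree (λ j j≢σv → []≔-minimal y a j j≢σv) v c w (λ w≡σv → σv∉e (subst (_∈ e) w≡σv w∈e))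
        resample : ∀ x → ∑[ a < 2+ r ] ∑[ b < 2+ r ] Γ (fix v (fixAll L (x [ σ v ]≔ a [ v ]≔ b)))
                       ≡ ∑[ a < 2+ r ] ∑[ b < 2+ r ] Γ (fixAll L (x [ σ v ]≔ a [ v ]≔ b))
        resample x = begin
          ∑[ a < 2+ r ] ∑[ b < 2+ r ] Γ (fix v (fixAll L (x [ σ v ]≔ a [ v ]≔ b)))
            ≡⟨ sum-cong-≗ (λ a → sum-cong-≗ λ b → local λ j _ →
                 trans (fix-cong v (fixAll-comm-pair L upᵥ v≢L upL x a b) j) (fix-pair upᵥ (fixAll L x) a b j)) ⟩
          ∑[ a < 2+ r ] ∑[ b < 2+ r ] Γ (fixAll L x [ σ v ]≔ a [ v ]≔ avoid a b)
            ≡⟨ sum-cong-≗ (λ a → sum-cong-≗ λ b → forget-σ (fixAll L x) a (avoid a b)) ⟩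
          ∑[ a < 2+ r ] ∑[ b < 2+ r ] Γ (fixAll L x [ v ]≔ avoid a b)
            ≡⟨ ∑∑-avoid (λ c → Γ (fixAll L x [ v ]≔ c)) ⟩
          ∑[ a < 2+ r ] ∑[ b < 2+ r ] Γ (fixAll L x [ v ]≔ b)
            ≡⟨ sum-cong-≗ (λ a → sum-cong-≗ λ b → forget-σ (fixAll L x) a b) ⟨
          ∑[ a < 2+ r ] ∑[ b < 2+ r ] Γ (fixAll L x [ σ v ]≔ a [ v ]≔ b)
            ≡⟨ sum-cong-≗ (λ a → sum-cong-≗ λ b → local λ j _ → fixAll-comm-pair L upᵥ v≢L upL x a b j) ⟨
          ∑[ a < 2+ r ] ∑[ b < 2+ r ] Γ (fixAll L (x [ σ v ]≔ a [ v ]≔ b)) ∎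

      sumMaps-fix-mono : ∀ Γ → Local Γ → ∀ L {v} → Upper v → All.All (v ≢_) L → All.All Upper L → Improves Γ v →
        sumMaps n (Γ ∘ fixAll L) ≤ sumMaps n (Γ ∘ fix v ∘ fixAll L)
      sumMaps-fix-mono Γ local L {v} upᵥ v≢L upL improves with σ v ∈? e | v ∈? e
      ... | no  σv∉e | _       = ≤-reflexive (sym (sumMaps-fix-σ∉ Γ local L upᵥ v≢L upL σv∉e))
      ... | yes σv∈e | yes v∈e = sumMaps-mono-≤ n (λ x → improves v∈e σv∈e (fixAll L x))
      ... | yes _    | no  v∉e = ≤-reflexive (sumMaps-cong n λ x → local λ w w∈e →
                                   sym (fix-minimal v _ w (λ w≡v → v∉e (subst (_∈ e) w≡v w∈e))))

      sumMaps-fixAll-mono : ∀ Γ → Local Γ → ∀ L → AllPairs _≢_ L → All.All Upper L → All.All (Improves Γ) L →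
        sumMaps n Γ ≤ sumMaps n (Γ ∘ fixAll L)
      sumMaps-fixAll-mono Γ local []      _              _               _ = ≤-refl
      sumMaps-fixAll-mono Γ local (v ∷ L) (v≢L AllPairs.∷ distinct) (upᵥ All.∷ upL) (imp All.∷ imps) =
        ≤-trans (sumMaps-fixAll-mono Γ local L distinct upL imps) (sumMaps-fix-mono Γ local L upᵥ v≢L upL imp)

      fix-improves-meets : ∀ {v} → Upper v → Improves (meets e) v
      fix-improves-meets {v} upᵥ v∈e σv∈e y = meets-mono e cover
        where
        cover : ∀ w → w ∈ e → ∃ λ w′ → w′ ∈ e × fix v y w′ ≡ y w
        cover w w∈e with w F.≟ v
        ... | no  w≢v  = w , w∈e , fix-minimal v y w w≢v
        ... | yes refl = cover-v (y w F.≟ y (σ w))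
          where
          cover-v : Dec (y w ≡ y (σ w)) → ∃ λ w′ → w′ ∈ e × fix w y w′ ≡ y w
          cover-v (yes yw≡yσw) = σ w , σv∈e , trans (fix-minimal w y (σ w) (upper⇒σ≢ upᵥ)) (sym yw≡yσw)
          cover-v (no  yw≢yσw) = w , w∈e , trans (fix-updates w y) (avoid-≢ yw≢yσw)

      sumMaps-fixAll-gain : ∀ (β : Fin n → Colouring → ℕ) →
        (∀ {v} → Upper v → v ∈ e → σ v ∈ e → ∀ x → meets e x + β v x ≤ meets e (fix v x)) →
        ∀ L → AllPairs _≢_ L → All.All Upper L → Any (λ v → v ∈ e × σ v ∈ e) L →
        ∃ λ v → (Upper v × v ∈ e × σ v ∈ e) ×
          sumMaps n (meets {r = 2+ r} e) + sumMaps n (β v) ≤ sumMaps n (meets e ∘ fixAll L)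
      sumMaps-fixAll-gain β gain (v ∷ L) (v≢L AllPairs.∷ distinct) (upᵥ All.∷ upL) (here (v∈e , σv∈e)) =
        v , (upᵥ , v∈e , σv∈e) , (begin
        sumMaps n (meets e) + sumMaps n (β v)         ≡⟨ sumMaps-distrib-+ n (meets e) (β v) ⟨
        sumMaps n (λ x → meets e x + β v x)           ≤⟨ sumMaps-mono-≤ n (gain upᵥ v∈e σv∈e) ⟩
        sumMaps n (meets e ∘ fix v)                   ≤⟨ sumMaps-fixAll-mono (meets e ∘ fix v) local L distinct upL
                                                           (All.zipWith (λ (upw , v≢w) → improves upw v≢w) (upL , v≢L)) ⟩
        sumMaps n (meets e ∘ fix v ∘ fixAll L)        ∎)
        where
        open ≤-Reasoning
        local : Local (meets e ∘ fix v)
        local {x} {y} x≡y = meets-cong e λ w w∈e → agree w w∈e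
          where
          agree : ∀ w → w ∈ e → fix v x w ≡ fix v y w
          agree w w∈e with w F.≟ v
          ... | yes refl = trans (fix-updates w x) (trans (cong₂ avoid (x≡y (σ w) σv∈e) (x≡y w w∈e)) (sym (fix-updates w y)))
          ... | no  w≢v  = trans (fix-minimal v x w w≢v) (trans (x≡y w w∈e) (sym (fix-minimal v y w w≢v)))
        improves : ∀ {w} → Upper w → v ≢ w → Improves (meets e ∘ fix v) w
        improves {w} upw v≢w w∈e σw∈e y = begin
          meets e (fix v y)           ≤⟨ fix-improves-meets upw w∈e σw∈e (fix v y) ⟩
          meets e (fix w (fix v y))   ≡⟨ meets-cong e (λ j _ → fix-comm upᵥ upw (≢-sym v≢w) y j) ⟩
          meets e (fix v (fix w y))   ∎
      sumMaps-fixAll-gain β gain (w ∷ L) (w≢L AllPairs.∷ distinct) (upw All.∷ upL) (there pairs) =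
        let v , props , le = sumMaps-fixAll-gain β gain L distinct upL pairs
        in v , props , ≤-trans le (sumMaps-fix-mono (meets e) (meets-cong e) L upw w≢L upL (fix-improves-meets upw))

      -- A cut earns a bonus at v when v and σ v lie in part 0 and the rest of e meets exactly the
      -- parts in U: then e misses part 1, but after fixing v it meets every part.
      bonus : Subset (2+ r) → Fin n → Colouring → ℕ
      bonus U v x = 𝟙 (x (σ v) F.≟ zero ×-dec x v F.≟ zero ×-dec image (e - σ v - v) x ≟ₛ U)

      ∈e-σv-v⁻ : ∀ {v w} → w ∈ e - σ v - v → w ∈ e × w ≢ σ v × w ≢ v
      ∈e-σv-v⁻ {v} w∈ =
        let w∈e-σv , w≢v = x∈p-y⁻ (e - σ v) w∈
            w∈e , w≢σv  = x∈p-y⁻ e w∈e-σv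
        in w∈e , w≢σv , w≢v

      bonus-gain : ∀ {U} → Admissible U → ∀ {v} → Upper v → v ∈ e → σ v ∈ e → ∀ x →
        meets e x + bonus U v x ≤ meets e (fix v x)
      bonus-gain {U} (1∉U , rest∈U) {v} upᵥ v∈e σv∈e x =
        gain (x (σ v) F.≟ zero ×-dec x v F.≟ zero ×-dec image (e - σ v - v) x ≟ₛ U)
        where
        gain : (d : Dec (x (σ v) ≡ zero × x v ≡ zero × image (e - σ v - v) x ≡ U)) → meets e x + 𝟙 d ≤ meets e (fix v x)
        gain (no _) = ≤-trans (≤-reflexive (+-identityʳ _)) (fix-improves-meets upᵥ v∈e σv∈e x)
        gain (yes (xσv≡0 , xv≡0 , img≡U)) = ≤-reflexive (cong₂ _+_ x-misses-1 (sym fix-meets))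
          where
          x-misses-1 : meets e x ≡ 0
          x-misses-1 = 𝟙-no (image e x ≟ₛ ⊤) λ img≡⊤ →
            let w , w∈e , xw≡1 = Equivalence.to (image≡⊤⇔surjectiveOn e x) img≡⊤ (suc zero)
            in 1∉U (one∈U (w F.≟ v) (w F.≟ σ v) w∈e xw≡1)
            where
            one∈U : ∀ {w} → Dec (w ≡ v) → Dec (w ≡ σ v) → w ∈ e → x w ≡ suc zero → suc zero ∈ U
            one∈U (yes refl) _          _   xw≡1 = contradiction (trans (sym xv≡0) xw≡1) F.0≢1+n
            one∈U (no  _)    (yes refl) _   xw≡1 = contradiction (trans (sym xσv≡0) xw≡1) F.0≢1+n
            one∈U (no w≢v)   (no w≢σv)  w∈e xw≡1 = subst (_∈ U) xw≡1 (subst (_ ∈_) img≡U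
              (∈-image⁺ (e - σ v - v) x (x∈p∧x≢y⇒x∈p-y (x∈p∧x≢y⇒x∈p-y w∈e w≢σv) w≢v)))
          fix-meets : meets e (fix v x) ≡ 1
          fix-meets = 𝟙-yes (image e (fix v x) ≟ₛ ⊤) (Equivalence.from (image≡⊤⇔surjectiveOn e (fix v x)) surj)
            where
            surj : SurjectiveOn e (fix v x)
            surj zero = σ v , σv∈e , trans (fix-minimal v x (σ v) (upper⇒σ≢ upᵥ)) xσv≡0
            surj (suc zero) = v , v∈e , trans (fix-updates v x) (trans (cong₂ avoid xσv≡0 xv≡0) (avoid-≡ zero))
            surj (suc (suc i)) =
              let w , w∈ , xw≡i = ∈-image⁻ (e - σ v - v) x (subst (suc (suc i) ∈_) (sym img≡U) (rest∈U _ (λ ()) (λ ())))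
                  w∈e , _ , w≢v = ∈e-σv-v⁻ w∈
              in w , w∈e , trans (fix-minimal v x w w≢v) xw≡i

      2+∣e-σv-v∣≡∣e∣ : ∀ {v} → Upper v → v ∈ e → σ v ∈ e → 2+ ∣ e - σ v - v ∣ ≡ ∣ e ∣
      2+∣e-σv-v∣≡∣e∣ {v} upᵥ v∈e σv∈e = trans
        (cong suc (suc∣p-x∣≡∣p∣ (e - σ v) (x∈p∧x≢y⇒x∈p-y v∈e (≢-sym (upper⇒σ≢ upᵥ)))))
        (suc∣p-x∣≡∣p∣ e σv∈e)

      sumMaps-bonus : ∀ U {v} → Upper v →
        2+ r * (2+ r * sumMaps n (bonus U v)) ≡ sumMaps n (λ x → 𝟙 (image (e - σ v - v) x ≟ₛ U))
      sumMaps-bonus U {v} upᵥ = trans (sym (sumMaps-pair (bonus U v) v)) (sumMaps-cong n λ x →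
        trans (sum-cong-≗ λ a → sum-cong-≗ λ b → localise x a b) (∑∑-𝟙-zero {suc r} (image (e - σ v - v) x ≟ₛ U)))
        where
        indicator : Fin (2+ r) → Fin (2+ r) → Subset (2+ r) → ℕ
        indicator a b W = 𝟙 (a F.≟ zero ×-dec b F.≟ zero ×-dec W ≟ₛ U)
        localise : ∀ x a b → bonus U v (x [ σ v ]≔ a [ v ]≔ b) ≡ indicator a b (image (e - σ v - v) x)
        localise x a b = begin
          indicator (P (σ v)) (P v) (image (e - σ v - v) P)
            ≡⟨ cong₂ (λ a′ b′ → indicator a′ b′ (image (e - σ v - v) P)) (pair-σ x v a b (upper⇒σ≢ upᵥ)) ([]≔-updates _ v b) ⟩
          indicator a b (image (e - σ v - v) P)
            ≡⟨ cong (indicator a b) (image-cong (e - σ v - v) λ w w∈ →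
                 let _ , w≢σv , w≢v = ∈e-σv-v⁻ w∈ in pair-minimal x v a b w w≢v w≢σv) ⟩
          indicator a b (image (e - σ v - v) x) ∎
          where
          open ≡-Reasoning
          P = x [ σ v ]≔ a [ v ]≔ b

      bonus-bound : ∀ {k U v} → 2+ k ≡ ∣ e ∣ → 0 < surjections k ∣ U ∣ → Upper v → v ∈ e → σ v ∈ e →
        2+ r ^ n ≤ 2+ r ^ ∣ e ∣ * sumMaps n (bonus U v)
      bonus-bound {k} {U} {v} ∣e∣≡2+k 0<surj upᵥ v∈e σv∈e = begin
        R ^ n
          ≤⟨ m≤n*m (R ^ n) _ ⦃ >-nonZero 0<surj ⦄ ⟩
        surjections k ∣ U ∣ * R ^ n
          ≡⟨ cong (λ j → surjections j ∣ U ∣ * R ^ n) ∣e′∣≡k ⟨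
        surjections ∣ e′ ∣ ∣ U ∣ * R ^ n
          ≡⟨ count-image n e′ U ⟨
        R ^ ∣ e′ ∣ * sumMaps n (λ x → 𝟙 (image e′ x ≟ₛ U))
          ≡⟨ cong (R ^ ∣ e′ ∣ *_) (sumMaps-bonus U upᵥ) ⟨
        R ^ ∣ e′ ∣ * (R * (R * sumMaps n (bonus U v)))
          ≡⟨ lemma (R ^ ∣ e′ ∣) R (sumMaps n (bonus U v)) ⟩
        R ^ (2+ ∣ e′ ∣) * sumMaps n (bonus U v)
          ≡⟨ cong (λ j → R ^ j * sumMaps n (bonus U v)) (2+∣e-σv-v∣≡∣e∣ upᵥ v∈e σv∈e) ⟩
        R ^ ∣ e ∣ * sumMaps n (bonus U v) ∎
        where
        open ≤-Reasoning
        R = 2+ r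
        e′ = e - σ v - v
        ∣e′∣≡k : ∣ e′ ∣ ≡ k
        ∣e′∣≡k = suc-injective (suc-injective (trans (2+∣e-σv-v∣≡∣e∣ upᵥ v∈e σv∈e) (sym ∣e∣≡2+k)))
        lemma : ∀ a b c → a * (b * (b * c)) ≡ b * (b * a) * c
        lemma = solve-∀

      edge-bound : ∀ {k} → 2+ k ≡ ∣ e ∣ → r ≤ k → ∀ L → AllPairs _≢_ L → All.All Upper L →
        (surjections ∣ e ∣ (2+ r) + 𝟙 (any? (λ v → v ∈? e ×-dec σ v ∈? e) L)) * 2+ r ^ n
          ≤ 2+ r ^ ∣ e ∣ * sumMaps n (meets e ∘ fixAll L)
      edge-bound {k} ∣e∣≡2+k r≤k L distinct upL with any? (λ v → v ∈? e ×-dec σ v ∈? e) L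
      ... | no _ = begin
        (S + 0) * R ^ n                               ≡⟨ cong (_* R ^ n) (+-identityʳ S) ⟩
        S * R ^ n                                     ≡⟨ sumMaps-meets n e ⟨
        R ^ ∣ e ∣ * sumMaps n (meets e)               ≤⟨ *-monoʳ-≤ (R ^ ∣ e ∣) (sumMaps-fixAll-mono (meets e) (meets-cong e)
                                                           L distinct upL (All.map fix-improves-meets upL)) ⟩
        R ^ ∣ e ∣ * sumMaps n (meets e ∘ fixAll L)    ∎
        where
        open ≤-Reasoning
        R = 2+ r
        S = surjections ∣ e ∣ R
      ... | yes pairs = begin
        (S + 1) * R ^ n
          ≡⟨ *-distribʳ-+ (R ^ n) S 1 ⟩
        S * R ^ n + 1 * R ^ n
          ≡⟨ cong (S * R ^ n +_) (*-identityˡ (R ^ n)) ⟩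
        S * R ^ n + R ^ n
          ≤⟨ +-mono-≤ (≤-reflexive (sym (sumMaps-meets n e)))
                                                                     (bonus-bound ∣e∣≡2+k 0<surj upᵥ v∈e σv∈e) ⟩
        R ^ ∣ e ∣ * sumMaps n (meets e) + R ^ ∣ e ∣ * sumMaps n (bonus U v)
                                                                 ≡⟨ *-distribˡ-+ (R ^ ∣ e ∣) _ _ ⟨
        R ^ ∣ e ∣ * (sumMaps n (meets e) + sumMaps n (bonus U v))
          ≤⟨ *-monoʳ-≤ (R ^ ∣ e ∣) gain ⟩
        R ^ ∣ e ∣ * sumMaps n (meets e ∘ fixAll L) ∎
        where
        open ≤-Reasoning
        R = 2+ r
        S = surjections ∣ e ∣ R
        chosen = admissible-with-surjections r≤k
        U = proj₁ chosen
        0<surj = proj₂ (proj₂ chosen)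
        gained = sumMaps-fixAll-gain (bonus U) (bonus-gain (proj₁ (proj₂ chosen))) L distinct upL pairs
        v = proj₁ gained
        upᵥ = proj₁ (proj₁ (proj₂ gained))
        v∈e = proj₁ (proj₂ (proj₁ (proj₂ gained)))
        σv∈e = proj₂ (proj₂ (proj₁ (proj₂ gained)))
        gain = proj₂ (proj₂ gained)

    sumMaps-cutSize-fixAll : ∀ {k} (H : MultiHypergraph k n) → 2+ r ≤ k → ∀ L → AllPairs _≢_ L → All.All Upper L →
      (numEdges H * surjections k (2+ r) + ∑[ i < numEdges H ] 𝟙 (any? (λ v → v ∈? edge H i ×-dec σ v ∈? edge H i) L))
        * 2+ r ^ n ≤ 2+ r ^ k * sumMaps n (cutSize H ∘ fixAll L)
    sumMaps-cutSize-fixAll {2+ k} H (s≤s (s≤s r≤k)) L distinct upL = begin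
      (m * S + sum P) * R ^ n
        ≡⟨ cong (λ t → (t + sum P) * R ^ n) m*S≡∑S ⟩
      (∑[ i < m ] S + sum P) * R ^ n
        ≡⟨ cong (_* R ^ n) (∑-distrib-+ (λ _ → S) P) ⟨
      (∑[ i < m ] (S + P i)) * R ^ n
        ≡⟨ *-distribʳ-sum (R ^ n) (λ i → S + P i) ⟩
      ∑[ i < m ] ((S + P i) * R ^ n)
        ≤⟨ ∑-mono-≤ per-edge ⟩
      ∑[ i < m ] (R ^ 2+ k * sumMaps n (meets (edge H i) ∘ fixAll L))
        ≡⟨ *-distribˡ-sum (R ^ 2+ k) (λ i → sumMaps n (meets (edge H i) ∘ fixAll L)) ⟨
      R ^ 2+ k * ∑[ i < m ] sumMaps n (meets (edge H i) ∘ fixAll L)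
        ≡⟨ cong (R ^ 2+ k *_) (sumMaps-comm-∑ n (λ x i → meets (edge H i) (fixAll L x))) ⟨
      R ^ 2+ k * sumMaps n (λ x → ∑[ i < m ] meets (edge H i) (fixAll L x))
        ≡⟨ cong (R ^ 2+ k *_) (sumMaps-cong n λ x → sym (cutSize≡∑meets H (fixAll L x))) ⟩
      R ^ 2+ k * sumMaps n (cutSize H ∘ fixAll L) ∎
      where
      open ≤-Reasoning
      R = 2+ r
      m = numEdges H
      S = surjections (2+ k) R
      P : Fin m → ℕ
      P i = 𝟙 (any? (λ v → v ∈? edge H i ×-dec σ v ∈? edge H i) L)
      m*S≡∑S : m * S ≡ ∑[ i < m ] S
      m*S≡∑S = sym (∑-const m S)
      per-edge : ∀ i → (S + P i) * R ^ n ≤ R ^ 2+ k * sumMaps n (meets (edge H i) ∘ fixAll L)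
      per-edge i = subst (λ j → (surjections j R + P i) * R ^ n ≤ R ^ j * sumMaps n (meets (edge H i) ∘ fixAll L))
        (∣edge∣≡k H i) (edge-bound (edge H i) (sym (∣edge∣≡k H i)) r≤k L distinct upL)

  -- Mirror involutions

  mirror : ∀ {n} → ℕ → Fin n → Fin n
  mirror {n} s u with toℕ u ≤? s | s ∸ toℕ u <? n
  ... | yes _ | yes s∸u<n = F.fromℕ< s∸u<n
  ... | _     | _         = u

  InRange : ℕ → ℕ → ℕ → Set
  InRange n s u = u ≤ s × s ∸ u < n

  mirror-spec : ∀ {n} s (u : Fin n) →
    (InRange n s (toℕ u) × toℕ (mirror s u) ≡ s ∸ toℕ u) ⊎ (¬ InRange n s (toℕ u) × mirror s u ≡ u)
  mirror-spec {n} s u with toℕ u ≤? s | s ∸ toℕ u <? n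
  ... | yes u≤s | yes s∸u<n = inj₁ ((u≤s , s∸u<n) , F.toℕ-fromℕ< s∸u<n)
  ... | yes _   | no  s∸u≮n = inj₂ (s∸u≮n ∘ proj₂ , refl)
  ... | no  u≰s | _         = inj₂ (u≰s ∘ proj₁ , refl)

  mirror-involutive : ∀ {n} s (u : Fin n) → mirror s (mirror s u) ≡ u
  mirror-involutive {n} s u with mirror-spec s u
  ... | inj₂ (_ , mirror≡u) = trans (cong (mirror s) mirror≡u) mirror≡u
  ... | inj₁ ((u≤s , s∸u<n) , toℕ-mirror) with mirror-spec s (mirror s u)
  ...   | inj₁ (_ , toℕ-mirror²) = F.toℕ-injective (trans toℕ-mirror² (trans (cong (s ∸_) toℕ-mirror) (m∸[m∸n]≡n u≤s)))
  ...   | inj₂ (out-of-range , _) = contradiction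
    ( subst (_≤ s) (sym toℕ-mirror) (m∸n≤m s (toℕ u))
    , subst (λ t → s ∸ t < n) (sym toℕ-mirror) (subst (_< n) (sym (m∸[m∸n]≡n u≤s)) (F.toℕ<n u)))
    out-of-range

  mirror-pair : ∀ {n} (u v : Fin n) → toℕ u < toℕ v → mirror (toℕ u + toℕ v) v ≡ u
  mirror-pair {n} u v u<v with mirror-spec (toℕ u + toℕ v) v
  ... | inj₁ (_ , toℕ-mirror) = F.toℕ-injective (trans toℕ-mirror (m+n∸n≡m (toℕ u) (toℕ v)))
  ... | inj₂ (out-of-range , _) = contradiction
    (m≤n+m (toℕ v) (toℕ u) , subst (_< n) (sym (m+n∸n≡m (toℕ u) (toℕ v))) (F.toℕ<n u)) out-of-range

  uppers : ∀ {n} → ℕ → List (Fin n)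
  uppers {n} s = List.filter (λ v → toℕ (mirror s v) <? toℕ v) (allFin n)

  uppers-distinct : ∀ {n} s → AllPairs _≢_ (uppers {n} s)
  uppers-distinct {n} s = Unique.filter⁺ (λ v → toℕ (mirror s v) <? toℕ v) (Unique.allFin⁺ n)

  uppers-upper : ∀ {n} s → All.All (λ v → toℕ (mirror s v) < toℕ v) (uppers {n} s)
  uppers-upper {n} s = All.all-filter (λ v → toℕ (mirror s v) <? toℕ v) (allFin n)

  two-members : ∀ {n} (e : Subset n) → 2 ≤ ∣ e ∣ → ∃ λ u → ∃ λ v → toℕ u < toℕ v × u ∈ e × v ∈ e
  two-members (outside ∷ e) 2≤∣e∣ with two-members e 2≤∣e∣
  ... | u , v , u<v , u∈e , v∈e = suc u , suc v , s≤s u<v , there u∈e , there v∈e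
  two-members (inside ∷ e) (s≤s 1≤∣e∣) = zero , suc (proj₁ member) , s≤s z≤n , here , there (proj₂ member)
    where
    member : Nonempty e
    member = ∣p∣>0⇒nonempty e 1≤∣e∣

  mirror-pair? : ∀ {n} (e : Subset n) s → Dec (Any (λ v → v ∈ e × mirror s v ∈ e) (uppers s))
  mirror-pair? e s = any? (λ v → v ∈? e ×-dec mirror s v ∈? e) (uppers s)

  some-mirror-pair : ∀ {n} (e : Subset n) → 2 ≤ ∣ e ∣ →
    ∃ λ (s : Fin (2 * n)) → Any (λ v → v ∈ e × mirror (toℕ s) v ∈ e) (uppers (toℕ s))
  some-mirror-pair {n} e 2≤∣e∣ =
    let u , v , u<v , u∈e , v∈e = two-members e 2≤∣e∣
        u+v<2n = +-mono-≤-< (<⇒≤ (F.toℕ<n u)) (subst (toℕ v <_) (sym (+-identityʳ n)) (F.toℕ<n v))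
        s = F.fromℕ< u+v<2n
        mirror-v≡u = trans (cong (λ t → mirror t v) (F.toℕ-fromℕ< u+v<2n)) (mirror-pair u v u<v)
        v-upper = subst (λ w → toℕ w < toℕ v) (sym mirror-v≡u) u<v
    in s , lose (∈-filter⁺ (λ w → toℕ (mirror (toℕ s) w) <? toℕ w) (∈-allFin v) v-upper)
                (v∈e , subst (_∈ e) (sym mirror-v≡u) u∈e)

  numEdges≡0 : ∀ {k} (H : MultiHypergraph k 0) → 0 < k → numEdges H ≡ 0
  numEdges≡0 H 0<k with edges H | uniform H
  ... | []     | _ = refl
  ... | [] ∷ _ | refl All.∷ _ = contradiction 0<k (<-irrefl refl)

  edges≤∑mirrorPairs : ∀ {k n} (H : MultiHypergraph k n) → 2 ≤ k →
    numEdges H ≤ ∑[ s < 2 * n ] ∑[ i < numEdges H ] 𝟙 (mirror-pair? (edge H i) (toℕ s))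
  edges≤∑mirrorPairs {n = n} H 2≤k = begin
    m
      ≡⟨ *-identityʳ m ⟨
    m * 1
      ≡⟨ ∑-const m 1 ⟨
    ∑[ i < m ] 1
      ≤⟨ ∑-mono-≤ has-pair ⟩
    ∑[ i < m ] ∑[ s < 2 * n ] 𝟙 (mirror-pair? (edge H i) (toℕ s))
      ≡⟨ ∑-comm {m} {2 * n} (λ i s → 𝟙 (mirror-pair? (edge H i) (toℕ s))) ⟩
    ∑[ s < 2 * n ] ∑[ i < m ] 𝟙 (mirror-pair? (edge H i) (toℕ s)) ∎
    where
    open ≤-Reasoning
    m = numEdges H
    has-pair : ∀ i → 1 ≤ ∑[ s < 2 * n ] 𝟙 (mirror-pair? (edge H i) (toℕ s))
    has-pair i =
      let s , pair = some-mirror-pair (edge H i) (subst (2 ≤_) (sym (∣edge∣≡k H i)) 2≤k)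
      in ≤-trans (≤-reflexive (sym (𝟙-yes (mirror-pair? (edge H i) (toℕ s)) pair)))
                 (term≤sum (λ s → 𝟙 (mirror-pair? (edge H i) (toℕ s))) s)

  large-cut : ∀ {k n r} (H : MultiHypergraph k n) → 2+ r ≤ k →
    ∃ λ (x : Cut n (2+ r)) → numEdges H + 2 * n * (surjections k (2+ r) * numEdges H) ≤ 2 * n * (2+ r ^ k * cutSize H x)
  large-cut {n = zero} H 2+r≤k = (λ ()) , ≤-reflexive (trans (+-identityʳ _) (numEdges≡0 H (≤-trans (s≤s z≤n) 2+r≤k)))
  large-cut {k} {n@(suc _)} {r} H 2+r≤k = fixAll L x , *-cancelˡ-≤ (R ^ n) ⦃ m^n≢0 R n ⦄ (begin
    R ^ n * (m + 2 * n * (D * m))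
      ≤⟨ *-monoʳ-≤ (R ^ n) (+-monoˡ-≤ (2 * n * (D * m)) m≤2n*pairs) ⟩
    R ^ n * (2 * n * pairs s + 2 * n * (D * m))
      ≡⟨ lemma₁ (R ^ n) (2 * n) (pairs s) D m ⟩
    2 * n * ((m * D + pairs s) * R ^ n)
      ≤⟨ *-monoʳ-≤ (2 * n) (sumMaps-cutSize-fixAll H 2+r≤k L (uppers-distinct _) (uppers-upper _)) ⟩
    2 * n * (R ^ k * sumMaps n (cutSize H ∘ fixAll L))
      ≤⟨ *-monoʳ-≤ (2 * n) (*-monoʳ-≤ (R ^ k) x-largest) ⟩
    2 * n * (R ^ k * (R ^ n * cutSize H (fixAll L x)))
      ≡⟨ lemma₂ (2 * n) (R ^ k) (R ^ n) (cutSize H (fixAll L x)) ⟩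
    R ^ n * (2 * n * (R ^ k * cutSize H (fixAll L x))) ∎)
    where
    open ≤-Reasoning
    R = 2+ r
    m = numEdges H
    D = surjections k R
    pairs : Fin (2 * n) → ℕ
    pairs s = ∑[ i < m ] 𝟙 (mirror-pair? (edge H i) (toℕ s))
    s = proj₁ (sum≤*largest pairs)
    m≤2n*pairs : m ≤ 2 * n * pairs s
    m≤2n*pairs = ≤-trans (edges≤∑mirrorPairs H (≤-trans (s≤s (s≤s z≤n)) 2+r≤k)) (proj₂ (sum≤*largest pairs))
    open Fixing {r = r} (mirror (toℕ s)) (mirror-involutive (toℕ s))
    L = uppers (toℕ s)
    x = proj₁ (sumMaps≤*largest n (cutSize H ∘ fixAll L))
    x-largest = proj₂ (sumMaps≤*largest n (cutSize H ∘ fixAll L))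
    lemma₁ : ∀ a b p d m → a * (b * p + b * (d * m)) ≡ b * ((m * d + p) * a)
    lemma₁ = solve-∀
    lemma₂ : ∀ a b c d → a * (b * (c * d)) ≡ c * (a * (b * d))
    lemma₂ = solve-∀

module Rationals where

  open import Data.Nat as ℕ using (ℕ; suc; NonZero)
  import Data.Nat.Properties as ℕ
  open import Data.Integer as ℤ using (+_; +≤+)
  import Data.Integer.Properties as ℤ
  open import Data.Rational using (ℚ; 0ℚ; 1ℚ; _/_; toℚᵘ; _+_; _*_; _-_; -_; _≤_; _<_)
  open import Data.Rational.Properties
  open import Data.Rational.Unnormalised as ℚᵘ using (mkℚᵘ; *≡*; *≤*)
  import Data.Rational.Unnormalised.Properties as ℚᵘ
  open import Data.Rational.Solver using (module +-*-Solver)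
  open import Relation.Binary.PropositionalEquality

  open import Defs using (ℕ→ℚ)

  -- ℕ→ℚ a is fromℚᵘ (mkℚᵘ (+ a) 0) by definition, so facts about ℕ→ℚ are checked in ℚᵘ.
  toℚᵘ-ℕ→ℚ : ∀ a → toℚᵘ (ℕ→ℚ a) ℚᵘ.≃ mkℚᵘ (+ a) 0
  toℚᵘ-ℕ→ℚ a = toℚᵘ-fromℚᵘ (mkℚᵘ (+ a) 0)

  ℕ→ℚ-+ : ∀ a b → ℕ→ℚ (a ℕ.+ b) ≡ ℕ→ℚ a + ℕ→ℚ b
  ℕ→ℚ-+ a b = toℚᵘ-injective (begin
    toℚᵘ (ℕ→ℚ (a ℕ.+ b))                ≈⟨ toℚᵘ-ℕ→ℚ (a ℕ.+ b) ⟩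
    mkℚᵘ (+ (a ℕ.+ b)) 0                ≈⟨ *≡* (cong (ℤ._* + 1) (trans (ℤ.pos-+ a b)
                                             (sym (cong₂ ℤ._+_ (ℤ.*-identityʳ (+ a)) (ℤ.*-identityʳ (+ b)))))) ⟩
    mkℚᵘ (+ a) 0 ℚᵘ.+ mkℚᵘ (+ b) 0      ≈⟨ ℚᵘ.+-cong (toℚᵘ-ℕ→ℚ a) (toℚᵘ-ℕ→ℚ b) ⟨
    toℚᵘ (ℕ→ℚ a) ℚᵘ.+ toℚᵘ (ℕ→ℚ b)      ≈⟨ toℚᵘ-homo-+ (ℕ→ℚ a) (ℕ→ℚ b) ⟨
    toℚᵘ (ℕ→ℚ a + ℕ→ℚ b)                ∎)
    where open ℚᵘ.≃-Reasoning

  ℕ→ℚ-* : ∀ a b → ℕ→ℚ (a ℕ.* b) ≡ ℕ→ℚ a * ℕ→ℚ b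
  ℕ→ℚ-* a b = toℚᵘ-injective (begin
    toℚᵘ (ℕ→ℚ (a ℕ.* b))                ≈⟨ toℚᵘ-ℕ→ℚ (a ℕ.* b) ⟩
    mkℚᵘ (+ (a ℕ.* b)) 0                ≈⟨ *≡* (cong (ℤ._* + 1) (ℤ.pos-* a b)) ⟩
    mkℚᵘ (+ a) 0 ℚᵘ.* mkℚᵘ (+ b) 0      ≈⟨ ℚᵘ.*-cong (toℚᵘ-ℕ→ℚ a) (toℚᵘ-ℕ→ℚ b) ⟨
    toℚᵘ (ℕ→ℚ a) ℚᵘ.* toℚᵘ (ℕ→ℚ b)      ≈⟨ toℚᵘ-homo-* (ℕ→ℚ a) (ℕ→ℚ b) ⟨
    toℚᵘ (ℕ→ℚ a * ℕ→ℚ b)                ∎)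
    where open ℚᵘ.≃-Reasoning

  ℕ→ℚ-mono-≤ : ∀ {a b} → a ℕ.≤ b → ℕ→ℚ a ≤ ℕ→ℚ b
  ℕ→ℚ-mono-≤ {a} {b} a≤b = toℚᵘ-cancel-≤
    (ℚᵘ.≤-respʳ-≃ (ℚᵘ.≃-sym (toℚᵘ-ℕ→ℚ b)) (ℚᵘ.≤-respˡ-≃ (ℚᵘ.≃-sym (toℚᵘ-ℕ→ℚ a))
      (*≤* (ℤ.*-monoʳ-≤-nonNeg (+ 1) (+≤+ a≤b)))))

  ℕ→ℚ-*-/ : ∀ a q .{{_ : NonZero q}} → ℕ→ℚ q * ((+ a) / q) ≡ ℕ→ℚ a
  ℕ→ℚ-*-/ a (suc q) = toℚᵘ-injective (begin
    toℚᵘ (ℕ→ℚ (suc q) * ((+ a) / suc q))          ≈⟨ toℚᵘ-homo-* (ℕ→ℚ (suc q)) ((+ a) / suc q) ⟩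
    toℚᵘ (ℕ→ℚ (suc q)) ℚᵘ.* toℚᵘ ((+ a) / suc q)  ≈⟨ ℚᵘ.*-cong (toℚᵘ-ℕ→ℚ (suc q)) (toℚᵘ-fromℚᵘ (mkℚᵘ (+ a) q)) ⟩
    mkℚᵘ (+ suc q) 0 ℚᵘ.* mkℚᵘ (+ a) q            ≈⟨ *≡* cross ⟩
    mkℚᵘ (+ a) 0                                  ≈⟨ toℚᵘ-ℕ→ℚ a ⟨
    toℚᵘ (ℕ→ℚ a)                                  ∎)
    where
    open ℚᵘ.≃-Reasoning
    cross : (+ suc q ℤ.* + a) ℤ.* + 1 ≡ + a ℤ.* + suc (q ℕ.+ 0)
    cross = trans (ℤ.*-identityʳ _) (trans (ℤ.*-comm (+ suc q) (+ a)) (cong (λ j → + a ℤ.* + suc j) (sym (ℕ.+-identityʳ q))))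

  open +-*-Solver

  p+q≤r⇒p≤r-q : ∀ {p q r} → p + q ≤ r → p ≤ r - q
  p+q≤r⇒p≤r-q {p} {q} {r} p+q≤r =
    subst (_≤ r - q) (solve 2 (λ p q → p :+ q :- q := p) refl p q) (+-monoˡ-≤ (- q) p+q≤r)

  excessConstant : ∀ Q .{{_ : NonZero Q}} → ℚ
  excessConstant Q = ((+ 1) / (2 ℕ.* Q)) {{ℕ.m*n≢0 2 Q}}

  0<excessConstant : ∀ Q .{{_ : NonZero Q}} → 0ℚ < excessConstant Q
  0<excessConstant Q = positive⁻¹ _ {{normalize-pos 1 (2 ℕ.* Q) {{ℕ.m*n≢0 2 Q}}}}

  excess-bound : ∀ m n z D Q .{{_ : NonZero Q}} →
    m ℕ.+ 2 ℕ.* n ℕ.* (D ℕ.* m) ℕ.≤ 2 ℕ.* n ℕ.* (Q ℕ.* z) →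
    excessConstant Q * ℕ→ℚ m ≤ ℕ→ℚ n * (ℕ→ℚ z - ((+ D) / Q) * ℕ→ℚ m)
  excess-bound m n z D Q m+2nDm≤2nQz = begin
    c * M
      ≤⟨ *-monoˡ-≤-nonNeg c {{normalize-nonNeg 1 (2 ℕ.* Q)}}
                                                            (p+q≤r⇒p≤r-q (subst₂ _≤_ lhs rhs (ℕ→ℚ-mono-≤ m+2nDm≤2nQz))) ⟩
    c * (two * N * (Q′ * Z) - two * N * (D′ * M))
      ≡⟨ cong (λ t → c * (two * N * (Q′ * Z) - two * N * (t * M))) Q′d≡D′ ⟨
    c * (two * N * (Q′ * Z) - two * N * (Q′ * d * M))
      ≡⟨ solve 7 (λ c two N Q′ Z d M →
        c :* (two :* N :* (Q′ :* Z) :- two :* N :* (Q′ :* d :* M)) := c :* (two :* Q′) :* (N :* (Z :- d :* M)))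
        refl c two N Q′ Z d M ⟩
    c * (two * Q′) * (N * (Z - d * M))
      ≡⟨ cong (_* (N * (Z - d * M))) c2Q′≡1 ⟩
    1ℚ * (N * (Z - d * M))
      ≡⟨ *-identityˡ _ ⟩
    N * (Z - d * M) ∎
    where
    open ≤-Reasoning
    instance _ = ℕ.m*n≢0 2 Q
    c = excessConstant Q
    d = (+ D) / Q
    two = ℕ→ℚ 2
    M = ℕ→ℚ m
    N = ℕ→ℚ n
    Z = ℕ→ℚ z
    D′ = ℕ→ℚ D
    Q′ = ℕ→ℚ Q
    c2Q′≡1 : c * (two * Q′) ≡ 1ℚ
    c2Q′≡1 = trans (*-comm c _) (trans (cong (_* c) (sym (ℕ→ℚ-* 2 Q))) (ℕ→ℚ-*-/ 1 (2 ℕ.* Q)))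
    Q′d≡D′ : Q′ * d ≡ D′
    Q′d≡D′ = ℕ→ℚ-*-/ D Q
    ℕ→ℚ-*-* : ∀ a b c d → ℕ→ℚ (a ℕ.* b ℕ.* (c ℕ.* d)) ≡ ℕ→ℚ a * ℕ→ℚ b * (ℕ→ℚ c * ℕ→ℚ d)
    ℕ→ℚ-*-* a b c d = trans (ℕ→ℚ-* (a ℕ.* b) _) (cong₂ _*_ (ℕ→ℚ-* a b) (ℕ→ℚ-* c d))
    lhs : ℕ→ℚ (m ℕ.+ 2 ℕ.* n ℕ.* (D ℕ.* m)) ≡ M + two * N * (D′ * M)
    lhs = trans (ℕ→ℚ-+ m _) (cong (λ t → M + t) (ℕ→ℚ-*-* 2 n D m))
    rhs : ℕ→ℚ (2 ℕ.* n ℕ.* (Q ℕ.* z)) ≡ two * N * (Q′ * Z)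
    rhs = ℕ→ℚ-*-* 2 n Q z

open import Defs
open import Data.Nat using (ℕ; _≤_; suc; _^_; s≤s; z≤n; NonZero)
open import Data.Nat.Properties using (m^n≢0)
open import Data.Product using (Σ; _×_; _,_)
open import Data.Rational using (ℚ; 0ℚ; _*_) renaming (_<_ to _<ℚ_; _≤_ to _≤ℚ_)

corollary3p2 : (k r : ℕ) → 2 ≤ r → r ≤ k →
    Σ ℚ (λ c → (0ℚ <ℚ c) ×
      ((n : ℕ) (H : MultiHypergraph k n) →
        Σ (Cut n r) (λ f → c * ℕ→ℚ (numEdges H) ≤ℚ ℕ→ℚ n * excess H f)))
corollary3p2 k (suc (suc r)) (s≤s (s≤s z≤n)) r≤k =
  Rationals.excessConstant Q , Rationals.0<excessConstant Q , λ n H →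
    let x , x-large = Counting.large-cut H r≤k
    in x , Rationals.excess-bound (numEdges H) n (cutSize H x) (Counting.surjections k (suc (suc r))) Q x-large
  where
  Q = suc (suc r) ^ k
  instance
    Q≢0 : NonZero Q
    Q≢0 = m^n≢0 (suc (suc r)) k
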